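{- There is an ESO formula $\phi$ of the form $\exists C_1\exists C_2\forall x\exists y\,\psi$, with $C_1,C_2$ monadic second-order variables and $\psi$ quantifier-free over the vocabulary $\{E\}$, such that for every basic graph $B$: $B\models\phi$ if and only if every connected component of $B$ contains a cycle whose length is a multiple of $3$.
   Context: A basic graph is a finite undirected graph without self-loops, viewed as a structure with a symmetric irreflexive binary relation $E$. A cycle has length at least $3$ and consists of distinct vertices. (In the paper's notation: $A_3\in\mathrm{FD}_{\mathrm{basic}}(E_1E_1ae)$, where $A_m$ is the set of undirected graphs in which every connected component contains a cycle of length a multiple of $m$.) -}

module Defs where

open import Data.Nat using (ℕ; zero; suc; _≤_)
open import Data.Nat.Divisibility using (_∣_)
open import Data.Fin using (Fin; inject₁; fromℕ) renaming (zero to fzero; suc to fsuc)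
open import Data.Bool using (Bool; true)
open import Data.Product using (Σ; _×_)
open import Data.Sum using (_⊎_)
open import Relation.Nullary using (¬_)
open import Relation.Binary.PropositionalEquality using (_≡_)
open import Function.Definitions using (Injective)

record BasicGraph : Set where
  field
    n      : ℕ
    E      : Fin n → Fin n → Bool
    sym    : ∀ u v → E u v ≡ E v u
    irrefl : ∀ u → ¬ (E u u ≡ true)
open BasicGraph public

Adj : (G : BasicGraph) → Fin (n G) → Fin (n G) → Set
Adj G u v = E G u v ≡ true

data Reach (G : BasicGraph) (u : Fin (n G)) : Fin (n G) → Set where
  here : Reach G u u
  step : ∀ {v w} → Reach G u v → Adj G v w → Reach G u w

-- A cycle of length (suc k): distinct vertices vs 0 .. vs k with
-- consecutive vertices adjacent and vs k adjacent to vs 0; length ≥ 3.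
record Cycle (G : BasicGraph) (k : ℕ) : Set where
  field
    vs       : Fin (suc k) → Fin (n G)
    long     : 3 ≤ suc k
    distinct : Injective _≡_ _≡_ vs
    edges    : ∀ (i : Fin k) → Adj G (vs (inject₁ i)) (vs (fsuc i))
    closing  : Adj G (vs (fromℕ k)) (vs fzero)
open Cycle public

CompHasCycle3 : (G : BasicGraph) → Fin (n G) → Set
CompHasCycle3 G u =
  Σ ℕ λ k → (3 ∣ suc k) × Σ (Cycle G k) λ c → Σ (Fin (suc k)) λ i → Reach G u (vs c i)

-- A_3: every connected component contains a cycle of length multiple of 3.
-- (Every component is the component of some vertex u.)
InA3 : BasicGraph → Set
InA3 G = ∀ (u : Fin (n G)) → CompHasCycle3 G u

data Var : Set where
  x y : Var

data QF : Set where
  edge : Var → Var → QF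
  col₁ : Var → QF
  col₂ : Var → QF
  eq   : Var → Var → QF
  neg  : QF → QF
  and  : QF → QF → QF
  or   : QF → QF → QF

⟦_⟧ : QF → (G : BasicGraph) → (Fin (n G) → Bool) → (Fin (n G) → Bool) →
      Fin (n G) → Fin (n G) → Set
⟦ edge u v ⟧ G C₁ C₂ a b = Adj G (val u) (val v)
  where val : Var → Fin (n G)
        val x = a
        val y = b
⟦ col₁ u ⟧ G C₁ C₂ a b = C₁ (val u) ≡ true
  where val : Var → Fin (n G)
        val x = a
        val y = b
⟦ col₂ u ⟧ G C₁ C₂ a b = C₂ (val u) ≡ true
  where val : Var → Fin (n G)
        val x = a
        val y = b
⟦ eq u v ⟧ G C₁ C₂ a b = val u ≡ val v
  where val : Var → Fin (n G)
        val x = a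
        val y = b
⟦ neg φ ⟧ G C₁ C₂ a b = ¬ (⟦ φ ⟧ G C₁ C₂ a b)
⟦ and φ χ ⟧ G C₁ C₂ a b = ⟦ φ ⟧ G C₁ C₂ a b × ⟦ χ ⟧ G C₁ C₂ a b
⟦ or φ χ ⟧ G C₁ C₂ a b = ⟦ φ ⟧ G C₁ C₂ a b ⊎ ⟦ χ ⟧ G C₁ C₂ a b

SatESO : QF → BasicGraph → Set
SatESO ψ G =
  Σ (Fin (n G) → Bool) λ C₁ → Σ (Fin (n G) → Bool) λ C₂ →
    ∀ (a : Fin (n G)) → Σ (Fin (n G)) λ b → ⟦ ψ ⟧ G C₁ C₂ a b

-- Read the predicates C₁, C₂ as a 3-colouring, the colour of v being coded by the pair
-- (C₁ v, C₂ v) ∈ {00, 10, 01}, and let ψ(x, y) say that y is a neighbour of x whose colour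
-- is one more (mod 3). If every x has such a y, following these choices from any vertex
-- eventually reaches a periodic point, whose orbit under its least period is a cycle in the
-- component along which the colour advances by one per step, so its length is divisible
-- by 3. Conversely, colour a cycle of length 3m in each component cyclically, and colour
-- every other vertex by walking back along a path to an already coloured vertex, one colour
-- less per step.
module Submission where

open import Defs renaming (sym to E-sym)
open import Data.Bool using (Bool; true; false)
open import Data.Bool.Properties using (¬-not; not-¬)
open import Data.Empty using (⊥-elim)
open import Data.Fin using (Fin; toℕ; inject₁; _≟_) renaming (zero to fzero; suc to fsuc)
open import Data.Fin.Properties using (pigeonhole; any?; toℕ-fromℕ; toℕ-inject₁; toℕ-injective; toℕ≤pred[n])
open import Data.Fin.Relation.Unary.Top using (view; ‵fromℕ; ‵inject₁)
open import Data.Maybe using (Maybe; just; nothing; _<∣>_)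
open import Data.Maybe.Properties using (just-injective)
open import Data.Nat using (ℕ; zero; suc; _+_; _*_; _∸_; _≤_; _<_; s≤s)
open import Data.Nat.Divisibility using (_∣_; divides-refl; ∣⇒≤; ∣-refl; ∣m∣n⇒∣m+n)
open import Data.Nat.GeneralisedArithmetic using (fold; fold-+)
open import Data.Nat.Properties
  using (+-comm; <-cmp; n<1+n; m<n⇒m<1+n; m<1+n⇒m<n∨m≡n; m≤n⇒∃[o]m+o≡n; m∸n+n≡m; m≤n+m; m≤n⇒m≤1+n;
         <⇒≤; ≤-trans)
open import Data.Product using (Σ; ∃; ∃₂; _×_; _,_; proj₁; proj₂)
open import Data.Sum using (_⊎_; inj₁; inj₂; [_,_]′)
open import Function using (_∘_; id)
open import Function.Definitions using (Injective)
open import Relation.Binary using (tri<; tri≈; tri>)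
open import Relation.Binary.PropositionalEquality
open import Relation.Nullary using (¬_; Dec; yes; no)
open import Relation.Unary using (Decidable)

module _ {p} {P : ℕ → Set p} (P? : Decidable P) where

  private
    NoneBelow : ℕ → Set p
    NoneBelow m = ∀ {j} → j < m → ¬ P j

    least-below : ∀ m → (∃ λ k → k < m × P k × NoneBelow k) ⊎ NoneBelow m
    least-below zero = inj₂ λ ()
    least-below (suc m) with least-below m
    ... | inj₁ (k , k<m , pk , none) = inj₁ (k , m<n⇒m<1+n k<m , pk , none)
    ... | inj₂ none with P? m
    ...   | yes pm = inj₁ (m , n<1+n m , pm , none)
    ...   | no ¬pm = inj₂ λ j<1+m → [ none , (λ { refl → ¬pm }) ]′ (m<1+n⇒m<n∨m≡n j<1+m)

  least : ∀ {m} → P m → ∃ λ k → P k × (∀ {j} → j < k → ¬ P j)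
  least {m} pm with least-below (suc m)
  ... | inj₁ (k , _ , pk , none) = k , pk , none
  ... | inj₂ none = ⊥-elim (none (n<1+n m) pm)

-- fold z f k is fᵏ z.
module _ {a} {A : Set a} (f : A → A) where

  fold-comm : ∀ z m k → fold (fold z f m) f k ≡ fold (fold z f k) f m
  fold-comm z m k = begin
    fold (fold z f m) f k  ≡⟨ fold-+ z f k ⟨
    fold z f (k + m)       ≡⟨ cong (fold z f) (+-comm k m) ⟩
    fold z f (m + k)       ≡⟨ fold-+ z f m ⟩
    fold (fold z f k) f m  ∎
    where open ≡-Reasoning

  fold-homo : ∀ {b} {B : Set b} (h : A → B) (g : B → B) → (∀ z → h (f z) ≡ g (h z)) →
              ∀ k z → h (fold z f k) ≡ fold (h z) g k
  fold-homo h g comm zero    z = refl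
  fold-homo h g comm (suc k) z = trans (comm (fold z f k)) (cong g (fold-homo h g comm k z))

  -- Rotating the period b = f^r (f^s b) shows that a period of f^s b is one of b.
  periodic-shift : ∀ {b L s d} → fold b f (suc L) ≡ b → s ≤ suc L →
                   fold (fold b f s) f d ≡ fold b f s → fold b f d ≡ b
  periodic-shift {b} {L} {s} {d} period s≤ fixed = begin
    fold b f d                ≡⟨ cong (λ z → fold z f d) back ⟨
    fold (fold c f r) f d     ≡⟨ fold-comm c r d ⟩
    fold (fold c f d) f r     ≡⟨ cong (λ z → fold z f r) fixed ⟩
    fold c f r                ≡⟨ back ⟩
    b                         ∎
    where
    open ≡-Reasoning
    c = fold b f s
    r = suc L ∸ s
    back : fold c f r ≡ b
    back = trans (sym (fold-+ b f r)) (trans (cong (fold b f) (m∸n+n≡m s≤)) period)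

  module _ {b L} (period : fold b f (suc L) ≡ b) (minimal : ∀ {o} → o < L → fold b f (suc o) ≢ b) where

    orbit-apart : ∀ {s t} → s < t → t ≤ L → fold b f s ≢ fold b f t
    orbit-apart {s} s<t t≤L same with m≤n⇒∃[o]m+o≡n s<t
    ... | o , refl =
      minimal (≤-trans (s≤s (m≤n+m o s)) t≤L) (periodic-shift {d = suc o} period s≤1+L shifted)
      where
      s≤1+L : s ≤ suc L
      s≤1+L = m≤n⇒m≤1+n (≤-trans (<⇒≤ s<t) t≤L)
      shifted : fold (fold b f s) f (suc o) ≡ fold b f s
      shifted = trans (sym (fold-+ b f (suc o))) (trans (cong (fold b f ∘ suc) (+-comm o s)) (sym same))

    orbit-injective : Injective _≡_ _≡_ (λ (i : Fin (suc L)) → fold b f (toℕ i))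
    orbit-injective {i} {j} same with <-cmp (toℕ i) (toℕ j)
    ... | tri< i<j _ _ = ⊥-elim (orbit-apart i<j (toℕ≤pred[n] j) same)
    ... | tri≈ _ i≡j _ = toℕ-injective i≡j
    ... | tri> _ _ j<i = ⊥-elim (orbit-apart j<i (toℕ≤pred[n] i) (sym same))

eventually-periodic : ∀ {m} (f : Fin m → Fin m) z → ∃₂ λ p L → fold (fold z f p) f (suc L) ≡ fold z f p
eventually-periodic {m} f z with pigeonhole (n<1+n m) (λ (i : Fin (suc m)) → fold z f (toℕ i))
... | i , j , i<j , same with m≤n⇒∃[o]m+o≡n i<j
... | o , i+o≡j = toℕ i , o , (begin
  fold (fold z f (toℕ i)) f (suc o)  ≡⟨ fold-+ z f (suc o) ⟨
  fold z f (suc (o + toℕ i))         ≡⟨ cong (fold z f) (trans (cong suc (+-comm o (toℕ i))) i+o≡j) ⟩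
  fold z f (toℕ j)                   ≡⟨ same ⟨
  fold z f (toℕ i)                   ∎)
  where open ≡-Reasoning

data Colour : Set where
  c₀ c₁ c₂ : Colour

next : Colour → Colour
next c₀ = c₁
next c₁ = c₂
next c₂ = c₀

prev : Colour → Colour
prev = next ∘ next

next³ : ∀ c → next (next (next c)) ≡ c
next³ c₀ = refl
next³ c₁ = refl
next³ c₂ = refl

fold-next-*3 : ∀ q c → fold c next (q * 3) ≡ c
fold-next-*3 zero    c = refl
fold-next-*3 (suc q) c = trans (next³ _) (fold-next-*3 q c)

3∣⇒fold-next≡ : ∀ {k} c → 3 ∣ k → fold c next k ≡ c
3∣⇒fold-next≡ c (divides-refl q) = fold-next-*3 q c

fold-next≡⇒3∣ : ∀ k c → fold c next k ≡ c → 3 ∣ k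
fold-next≡⇒3∣ 0 c  _  = divides-refl 0
fold-next≡⇒3∣ 1 c₀ ()
fold-next≡⇒3∣ 1 c₁ ()
fold-next≡⇒3∣ 1 c₂ ()
fold-next≡⇒3∣ 2 c₀ ()
fold-next≡⇒3∣ 2 c₁ ()
fold-next≡⇒3∣ 2 c₂ ()
fold-next≡⇒3∣ (suc (suc (suc k))) c same =
  ∣m∣n⇒∣m+n ∣-refl (fold-next≡⇒3∣ k c (trans (sym (next³ _)) same))

-- The colour c is coded by (C₁, C₂) = (bit₁ c, bit₂ c); the unused code (true, true) decodes to c₀.
bit₁ bit₂ : Colour → Bool
bit₁ c₁ = true
bit₁ _  = false
bit₂ c₂ = true
bit₂ _  = false

Codes : Colour → Bool → Bool → Set
Codes c p q = p ≡ bit₁ c × q ≡ bit₂ c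

decode : Bool → Bool → Colour
decode true  false = c₁
decode false true  = c₂
decode _     _     = c₀

decode-codes : ∀ c {p q} → Codes c p q → decode p q ≡ c
decode-codes c₀ (refl , refl) = refl
decode-codes c₁ (refl , refl) = refl
decode-codes c₂ (refl , refl) = refl

literal : Bool → QF → QF
literal true  φ = φ
literal false φ = neg φ

hasColour : Colour → Var → QF
hasColour c v = and (literal (bit₁ c) (col₁ v)) (literal (bit₂ c) (col₂ v))

someColour : (Colour → QF) → QF
someColour φ = or (φ c₀) (or (φ c₁) (φ c₂))

colourStep : Colour → QF
colourStep c = and (hasColour c x) (hasColour (next c) y)

upNeighbour : QF
upNeighbour = and (edge x y) (someColour colourStep)

module _ {G : BasicGraph} {C₁ C₂ : Fin (n G) → Bool} {a b : Fin (n G)} where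

  private
    at : Var → Fin (n G)
    at x = a
    at y = b

  hasColour-sound : ∀ c v → ⟦ hasColour c v ⟧ G C₁ C₂ a b → Codes c (C₁ (at v)) (C₂ (at v))
  hasColour-sound c₀ x (h₁ , h₂) = ¬-not h₁ , ¬-not h₂
  hasColour-sound c₀ y (h₁ , h₂) = ¬-not h₁ , ¬-not h₂
  hasColour-sound c₁ x (h₁ , h₂) = h₁ , ¬-not h₂
  hasColour-sound c₁ y (h₁ , h₂) = h₁ , ¬-not h₂
  hasColour-sound c₂ x (h₁ , h₂) = ¬-not h₁ , h₂
  hasColour-sound c₂ y (h₁ , h₂) = ¬-not h₁ , h₂

  hasColour-complete : ∀ c v → Codes c (C₁ (at v)) (C₂ (at v)) → ⟦ hasColour c v ⟧ G C₁ C₂ a b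
  hasColour-complete c₀ x (e₁ , e₂) = not-¬ e₁ , not-¬ e₂
  hasColour-complete c₀ y (e₁ , e₂) = not-¬ e₁ , not-¬ e₂
  hasColour-complete c₁ x (e₁ , e₂) = e₁ , not-¬ e₂
  hasColour-complete c₁ y (e₁ , e₂) = e₁ , not-¬ e₂
  hasColour-complete c₂ x (e₁ , e₂) = not-¬ e₁ , e₂
  hasColour-complete c₂ y (e₁ , e₂) = not-¬ e₁ , e₂

  someColour-elim : ∀ φ → ⟦ someColour φ ⟧ G C₁ C₂ a b → ∃ λ c → ⟦ φ c ⟧ G C₁ C₂ a b
  someColour-elim φ (inj₁ h)        = c₀ , h
  someColour-elim φ (inj₂ (inj₁ h)) = c₁ , h
  someColour-elim φ (inj₂ (inj₂ h)) = c₂ , h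

  someColour-intro : ∀ φ c → ⟦ φ c ⟧ G C₁ C₂ a b → ⟦ someColour φ ⟧ G C₁ C₂ a b
  someColour-intro φ c₀ h = inj₁ h
  someColour-intro φ c₁ h = inj₂ (inj₁ h)
  someColour-intro φ c₂ h = inj₂ (inj₂ h)

  upNeighbour-sound : ⟦ upNeighbour ⟧ G C₁ C₂ a b →
                      Adj G a b × decode (C₁ b) (C₂ b) ≡ next (decode (C₁ a) (C₂ a))
  upNeighbour-sound (a~b , h) with someColour-elim colourStep h
  ... | c , ha , hb = a~b , trans (decode-codes (next c) (hasColour-sound (next c) y hb))
                                  (cong next (sym (decode-codes c (hasColour-sound c x ha))))

  upNeighbour-complete : ∀ {c} → Adj G a b → Codes c (C₁ a) (C₂ a) → Codes (next c) (C₁ b) (C₂ b) →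
                         ⟦ upNeighbour ⟧ G C₁ C₂ a b
  upNeighbour-complete {c} a~b ca cb =
    a~b , someColour-intro colourStep c (hasColour-complete c x ca , hasColour-complete (next c) y cb)

record SuccessorColouring (G : BasicGraph) : Set where
  field
    colour      : Fin (n G) → Colour
    up          : Fin (n G) → Fin (n G)
    up-adjacent : ∀ v → Adj G v (up v)
    colour-up   : ∀ v → colour (up v) ≡ next (colour v)

module _ {G : BasicGraph} where

  Adj-sym : ∀ {u v} → Adj G u v → Adj G v u
  Adj-sym {u} {v} u~v = trans (E-sym G v u) u~v

  Reach-trans : ∀ {u v w} → Reach G u v → Reach G v w → Reach G u w
  Reach-trans u⇝v here           = u⇝v
  Reach-trans u⇝v (step v⇝w w~z) = step (Reach-trans u⇝v v⇝w) w~z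

  Reach-sym : ∀ {u v} → Reach G u v → Reach G v u
  Reach-sym here           = here
  Reach-sym (step u⇝v v~w) = Reach-trans (step here (Adj-sym v~w)) (Reach-sym u⇝v)

  path-reach : ∀ {k} (p : Fin (suc k) → Fin (n G)) → (∀ i → Adj G (p (inject₁ i)) (p (fsuc i))) →
               ∀ j → Reach G (p fzero) (p j)
  path-reach p p~ fzero = here
  path-reach {suc k} p p~ (fsuc j) =
    Reach-trans (step here (p~ fzero)) (path-reach (p ∘ fsuc) (p~ ∘ fsuc) j)

  Cycle-reach : ∀ {k} (C : Cycle G k) i j → Reach G (vs C i) (vs C j)
  Cycle-reach C i j =
    Reach-trans (Reach-sym (path-reach (vs C) (edges C) i)) (path-reach (vs C) (edges C) j)

module _ {G : BasicGraph} (S : SuccessorColouring G) where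
  open SuccessorColouring S

  reach-up : ∀ k v → Reach G v (fold v up k)
  reach-up zero    v = here
  reach-up (suc k) v = step (reach-up k v) (up-adjacent (fold v up k))

  period-divisible : ∀ {b L} → fold b up (suc L) ≡ b → 3 ∣ suc L
  period-divisible {b} {L} period =
    fold-next≡⇒3∣ (suc L) (colour b)
      (trans (sym (fold-homo up colour next colour-up (suc L) b)) (cong colour period))

  periodic-orbit : ∀ b L → fold b up (suc L) ≡ b → (∀ {o} → o < L → fold b up (suc o) ≢ b) → Cycle G L
  periodic-orbit b L period minimal = record
    { vs       = λ i → fold b up (toℕ i)
    ; long     = ∣⇒≤ (period-divisible period)
    ; distinct = orbit-injective up period minimal
    ; edges    = λ i → subst (λ t → Adj G (fold b up t) (fold b up (suc (toℕ i))))
                             (sym (toℕ-inject₁ i)) (up-adjacent _)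
    ; closing  = subst (λ t → Adj G (fold b up t) b)
                       (sym (toℕ-fromℕ L)) (subst (Adj G _) period (up-adjacent _))
    }

  successorColouring⇒InA3 : InA3 G
  successorColouring⇒InA3 u with eventually-periodic up u
  ... | p , L₀ , period₀ with least (λ L → fold (fold u up p) up (suc L) ≟ fold u up p) {L₀} period₀
  ... | L , period , minimal =
    L , period-divisible period , periodic-orbit (fold u up p) L period minimal , fzero , reach-up p u

-- A partial successor colouring: v ↦ just (colour of v, its up-neighbour).
module PartialColourings (G : BasicGraph) where

  Vertex : Set
  Vertex = Fin (n G)

  Partial : Set
  Partial = Vertex → Maybe (Colour × Vertex)

  Defined : Partial → Vertex → Set
  Defined π v = ∃ λ e → π v ≡ just e

  defined? : ∀ π v → Dec (Defined π v)
  defined? π v with π v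
  ... | just e  = yes (e , refl)
  ... | nothing = no λ ()

  ConsistentWithin : Partial → Partial → Set
  ConsistentWithin ν π = ∀ {v c w} → ν v ≡ just (c , w) → Adj G v w × ∃ λ w′ → π w ≡ just (next c , w′)

  Consistent : Partial → Set
  Consistent π = ConsistentWithin π π

  _⊑_ : Partial → Partial → Set
  π ⊑ π′ = ∀ {v e} → π v ≡ just e → π′ v ≡ just e

  ⊑-refl : ∀ {π} → π ⊑ π
  ⊑-refl πv = πv

  ⊑-trans : ∀ {π π′ π″} → π ⊑ π′ → π′ ⊑ π″ → π ⊑ π″
  ⊑-trans π⊑π′ π′⊑π″ πv = π′⊑π″ (π⊑π′ πv)

  Defined-⊑ : ∀ {π π′ v} → π ⊑ π′ → Defined π v → Defined π′ v
  Defined-⊑ π⊑π′ (e , πv) = e , π⊑π′ πv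

  ConsistentExtension : Partial → (Partial → Set) → Set
  ConsistentExtension π P = ∃ λ π′ → Consistent π′ × π ⊑ π′ × P π′

  extension-⊑ : ∀ {π π′ P} → π ⊑ π′ → ConsistentExtension π′ P → ConsistentExtension π P
  extension-⊑ {π} {π′} π⊑π′ (π″ , con , π′⊑π″ , p) = π″ , con , ⊑-trans {π} {π′} {π″} π⊑π′ π′⊑π″ , p

  _▷_ : Partial → Partial → Partial
  (ν ▷ π) v = ν v <∣> π v

  Fresh : Partial → Partial → Set
  Fresh ν π = ∀ v → Defined π v → ν v ≡ nothing

  module _ {ν π : Partial} (fresh : Fresh ν π) where

    ▷-⊑ : π ⊑ (ν ▷ π)
    ▷-⊑ {v} πv rewrite fresh v (_ , πv) = πv

    ▷-consistent : Consistent π → ConsistentWithin ν (ν ▷ π) → Consistent (ν ▷ π)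
    ▷-consistent con new {v} νπv with ν v in νv
    ... | just _  = new (trans νv νπv)
    ... | nothing with con νπv
    ...   | v~w , w′ , πw = v~w , w′ , ▷-⊑ πw

  single : Vertex → Colour × Vertex → Partial
  single v e z with z ≟ v
  ... | yes _ = just e
  ... | no _  = nothing

  single-at : ∀ v e → single v e v ≡ just e
  single-at v e with v ≟ v
  ... | yes _   = refl
  ... | no v≢v  = ⊥-elim (v≢v refl)

  -- Walking back along the path, each undefined vertex gets the colour preceding its successor's.
  extend-along : ∀ {u w} → Reach G u w → ∀ {π} → Consistent π → Defined π w →
                 ConsistentExtension π (λ π′ → Defined π′ u)
  extend-along here {π} con dw = π , con , ⊑-refl {π} , dw
  extend-along (step {v} {w} u⇝v v~w) {π} con ((c , w′) , πw) with defined? π v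
  ... | yes dv = extend-along u⇝v con dv
  ... | no ¬dv = extension-⊑ {π} (▷-⊑ fresh)
                   (extend-along u⇝v (▷-consistent fresh con new) (e , cong (_<∣> π v) (single-at v e)))
    where
    e = (prev c , w)

    fresh : Fresh (single v e) π
    fresh z dz with z ≟ v
    ... | yes refl = ⊥-elim (¬dv dz)
    ... | no _     = refl

    new : ConsistentWithin (single v e) (single v e ▷ π)
    new {z} s with z ≟ v
    new refl | yes refl =
      v~w , w′ , subst (λ c′ → (single v e ▷ π) w ≡ just (c′ , w′)) (sym (next³ c)) (▷-⊑ fresh πw)
    new ()   | no _

  module _ {k} (C : Cycle G k) (3∣1+k : 3 ∣ suc k) where

    successor : Fin (suc k) → Fin (suc k)
    successor i with view i
    ... | ‵fromℕ      = fzero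
    ... | ‵inject₁ j  = fsuc j

    successor-adjacent : ∀ i → Adj G (vs C i) (vs C (successor i))
    successor-adjacent i with view i
    ... | ‵fromℕ      = closing C
    ... | ‵inject₁ j  = edges C j

    cycleColour : Fin (suc k) → Colour
    cycleColour i = fold c₀ next (toℕ i)

    cycleColour-successor : ∀ i → cycleColour (successor i) ≡ next (cycleColour i)
    cycleColour-successor i with view i
    ... | ‵fromℕ      = sym (trans (cong (fold c₀ next ∘ suc) (toℕ-fromℕ k)) (3∣⇒fold-next≡ c₀ 3∣1+k))
    ... | ‵inject₁ j  = cong (next ∘ fold c₀ next) (sym (toℕ-inject₁ j))

    onCycle : Partial
    onCycle z with any? (λ i → vs C i ≟ z)
    ... | yes (i , _) = just (cycleColour i , vs C (successor i))
    ... | no _        = nothing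

    onCycle-at : ∀ i → onCycle (vs C i) ≡ just (cycleColour i , vs C (successor i))
    onCycle-at i with any? (λ j → vs C j ≟ vs C i)
    ... | yes (j , same) rewrite distinct C same = refl
    ... | no none = ⊥-elim (none (i , refl))

    cycle-vertex-defined : ∀ {π} → Consistent π →
                           ConsistentExtension π (λ π′ → ∃ λ j → Defined π′ (vs C j))
    cycle-vertex-defined {π} con with any? (λ j → defined? π (vs C j))
    ... | yes (j , dj) = π , con , ⊑-refl {π} , j , dj
    ... | no none = onCycle ▷ π , ▷-consistent fresh con new , ▷-⊑ fresh ,
                    fzero , _ , cong (_<∣> π (vs C fzero)) (onCycle-at fzero)
      where
      fresh : Fresh onCycle π
      fresh z dz with any? (λ i → vs C i ≟ z)
      ... | yes (i , refl) = ⊥-elim (none (i , dz))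
      ... | no _           = refl

      new : ConsistentWithin onCycle (onCycle ▷ π)
      new {z} s with any? (λ i → vs C i ≟ z)
      new refl | yes (i , refl) =
        successor-adjacent i , vs C (successor (successor i)) ,
        trans (cong (_<∣> π (vs C (successor i))) (onCycle-at (successor i)))
              (cong (λ c → just (c , vs C (successor (successor i)))) (cycleColour-successor i))
      new ()   | no _

  module _ (A3 : InA3 G) where

    define-vertex : ∀ u {π} → Consistent π → ConsistentExtension π (λ π′ → Defined π′ u)
    define-vertex u {π} con with A3 u
    ... | k , 3∣1+k , C , i , u⇝i with cycle-vertex-defined C 3∣1+k con
    ... | π₁ , con₁ , π⊑π₁ , j , dj =
      extension-⊑ {π} π⊑π₁ (extend-along (Reach-trans u⇝i (Cycle-reach C i j)) con₁ dj)

    define-all : ∀ {m} (us : Fin m → Vertex) {π} → Consistent π →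
                 ConsistentExtension π (λ π′ → ∀ i → Defined π′ (us i))
    define-all {zero} us {π} con = π , con , ⊑-refl {π} , λ ()
    define-all {suc m} us {π} con with define-vertex (us fzero) con
    ... | π₁ , con₁ , π⊑π₁ , d₀ with define-all (us ∘ fsuc) con₁
    ... | π₂ , con₂ , π₁⊑π₂ , ds =
      π₂ , con₂ , ⊑-trans {π} {π₁} π⊑π₁ π₁⊑π₂ , λ { fzero → Defined-⊑ {π₁} π₁⊑π₂ d₀ ; (fsuc i) → ds i }

  total-colouring : ∀ {π} → Consistent π → (∀ v → Defined π v) → SuccessorColouring G
  total-colouring con total = record
    { colour      = proj₁ ∘ entry
    ; up          = proj₂ ∘ entry
    ; up-adjacent = λ v → proj₁ (con (proj₂ (total v)))
    ; colour-up   = colour-up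
    }
    where
    entry : Vertex → Colour × Vertex
    entry v = proj₁ (total v)

    colour-up : ∀ v → proj₁ (entry (proj₂ (entry v))) ≡ next (proj₁ (entry v))
    colour-up v with con (proj₂ (total v))
    ... | _ , _ , πw = cong proj₁ (just-injective (trans (sym (proj₂ (total _))) πw))

  InA3⇒successorColouring : InA3 G → SuccessorColouring G
  InA3⇒successorColouring A3 =
    let _ , con , _ , total = define-all A3 id {λ _ → nothing} (λ ()) in total-colouring con total

open PartialColourings using (InA3⇒successorColouring)

module _ {G : BasicGraph} where

  SatESO⇒successorColouring : SatESO upNeighbour G → SuccessorColouring G
  SatESO⇒successorColouring (C₁ , C₂ , sat) = record
    { colour      = λ v → decode (C₁ v) (C₂ v)
    ; up          = proj₁ ∘ sat
    ; up-adjacent = proj₁ ∘ up-step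
    ; colour-up   = proj₂ ∘ up-step
    }
    where
    up-step : ∀ v → Adj G v (proj₁ (sat v)) ×
                 decode (C₁ (proj₁ (sat v))) (C₂ (proj₁ (sat v))) ≡ next (decode (C₁ v) (C₂ v))
    up-step v = upNeighbour-sound {G} {C₁} {C₂} {v} (proj₂ (sat v))

  successorColouring⇒SatESO : SuccessorColouring G → SatESO upNeighbour G
  successorColouring⇒SatESO S = C₁ , C₂ , λ v →
    up v , upNeighbour-complete {G} {C₁} {C₂} (up-adjacent v) (refl , refl)
                                (cong bit₁ (colour-up v) , cong bit₂ (colour-up v))
    where
    open SuccessorColouring S
    C₁ C₂ : Fin (n G) → Bool
    C₁ = bit₁ ∘ colour
    C₂ = bit₂ ∘ colour

lemma2 : Σ QF λ ψ → ∀ (G : BasicGraph) → (SatESO ψ G → InA3 G) × (InA3 G → SatESO ψ G)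
lemma2 = upNeighbour , λ G →
  successorColouring⇒InA3 ∘ SatESO⇒successorColouring ,
  successorColouring⇒SatESO ∘ InA3⇒successorColouring G
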